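{- Let $\mathcal X$ be the fundamental pattern of a matroid $M$. Then a matroid $M'$ is an adjoint of $M$ if and only if (with the ground set of $M'$ identified with the set of row labels of $\mathcal X$, i.e., with the set of hyperplanes of $M$) $M'\in\mathcal R(\mathcal X^T)$ and $r(M')=r(M)$.
   Context: The fundamental pattern of a matroid $M$ is the $\{0,*\}$-matrix with one row for each hyperplane of $M$ and one column for each element of $E(M)$, whose entry in row $H$, column $e$ is $0$ if and only if $e\in H$. For a zero-nonzero pattern $\mathcal Y$, the zero set of a row is the set of column labels where that row has entry $0$, and $\mathcal R(\mathcal Y)$ is the set of all matroids on the set of column labels of $\mathcal Y$ such that the zero set of every row of $\mathcal Y$ is a flat. A simple matroid $M'$ is an adjoint of a matroid $M$ if $r(M')=r(M)$ and there is a map $\phi:L(M)\to L(M')$ between lattices of flats such that (i) $\phi$ is injective; (ii) if $F_1\subseteq F_2$ are flats of $M$ then $\phi(F_2)\subseteq\phi(F_1)$; (iii) $\phi$ restricts to a bijection from the hyperplanes of $M$ onto the points (rank-$1$ flats) of $M'$. -}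

module Defs where

open import Data.Nat using (ℕ; zero; suc; _+_; _≤_; _<_)
open import Data.Fin using (Fin)
open import Data.Fin.Subset using (Subset; _∈_; _∉_; _⊆_; _∪_; _∩_; ⁅_⁆; ⊤; ∣_∣)
open import Data.Fin.Subset.Properties using (_∈?_)
open import Data.Product using (Σ; _×_; ∃)
open import Relation.Binary.PropositionalEquality using (_≡_; _≢_)
open import Relation.Nullary using (yes; no)
open import Data.Vec using (tabulate)
open import Data.Bool using (Bool; true; false)

-- A matroid on the ground set Fin n, given by its rank function
-- (standard rank axioms R1-R3; nonnegativity is automatic in ℕ).
record Matroid (n : ℕ) : Set where
  field
    rk        : Subset n → ℕ
    rk-bound  : ∀ X → rk X ≤ ∣ X ∣
    rk-mono   : ∀ {X Y} → X ⊆ Y → rk X ≤ rk Y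
    rk-submod : ∀ X Y → rk (X ∪ Y) + rk (X ∩ Y) ≤ rk X + rk Y

open Matroid public

rank : ∀ {n} → Matroid n → ℕ
rank M = rk M ⊤

IsFlat : ∀ {n} → Matroid n → Subset n → Set
IsFlat M F = ∀ e → e ∉ F → rk M F < rk M (F ∪ ⁅ e ⁆)

IsHyperplane : ∀ {n} → Matroid n → Subset n → Set
IsHyperplane M H = IsFlat M H × suc (rk M H) ≡ rank M

IsPoint : ∀ {n} → Matroid n → Subset n → Set
IsPoint M P = IsFlat M P × rk M P ≡ 1

Simple : ∀ {n} → Matroid n → Set
Simple M = (∀ e → rk M ⁅ e ⁆ ≡ 1) × (∀ e f → e ≢ f → rk M (⁅ e ⁆ ∪ ⁅ f ⁆) ≡ 2)

-- This is how the row labels of the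
-- fundamental pattern (= hyperplanes of M) are identified with Fin m.
IsHyperplaneEnum : ∀ {n m} → Matroid n → (Fin m → Subset n) → Set
IsHyperplaneEnum M h =
  (∀ i j → h i ≡ h j → i ≡ j) ×
  (∀ i → IsHyperplane M (h i)) ×
  (∀ H → IsHyperplane M H → ∃ λ i → h i ≡ H)

data Entry : Set where
  zer  : Entry
  star : Entry

Pattern : ℕ → ℕ → Set
Pattern r c = Fin r → Fin c → Entry

transpose : ∀ {r c} → Pattern r c → Pattern c r
transpose Y j i = Y i j

zeroSet : ∀ {r c} → Pattern r c → Fin r → Subset c
zeroSet Y i = tabulate (λ j → isZero (Y i j))
  where
  isZero : Entry → Bool
  isZero zer  = true
  isZero star = false

_∈R_ : ∀ {r c} → Matroid c → Pattern r c → Set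
_∈R_ {r} M Y = ∀ (i : Fin r) → IsFlat M (zeroSet Y i)

fundamentalPattern : ∀ {n m} → (Fin m → Subset n) → Pattern m n
fundamentalPattern h i e with e ∈? h i
... | yes _ = zer
... | no  _ = star

IsAdjoint : ∀ {n m} → Matroid n → (Fin m → Subset n) → Matroid m → Set
IsAdjoint {n} {m} M h M' =
  Simple M' × rank M' ≡ rank M ×
  Σ (Subset n → Subset m) λ φ →
    (∀ F → IsFlat M F → IsFlat M' (φ F)) ×
    (∀ F G → IsFlat M F → IsFlat M G → φ F ≡ φ G → F ≡ G) ×
    (∀ F G → IsFlat M F → IsFlat M G → F ⊆ G → φ G ⊆ φ F) ×
    (∀ i → φ (h i) ≡ ⁅ i ⁆ × IsPoint M' (φ (h i)))

-- Sending a flat F to the set of hyperplanes containing it reverses inclusions and, since every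
-- flat is the intersection of the hyperplanes containing it, is injective on flats; its value
-- at F is the intersection of the zero sets of the columns e ∈ F. So if those zero sets are
-- flats of M' and r(M') = r(M), this map is an adjoint (and forces M' to be simple).
-- Conversely, an adjoint φ strictly reverses chains of flats and maps hyperplanes to points,
-- so r'(φ F) + r(F) = r(M); hence two distinct copoints of a flat X go to two flats covering
-- φ X in M', which therefore meet in φ X. Descending through copoints containing e, this shows
-- that j ∈ φ F forces F ⊆ H_j, so the zero set of column e is the flat φ(cl{e}).
module Submission where

open import Defs
open import Data.Nat using (ℕ; zero; suc; _+_; _∸_; _≤_; _<_; z≤n; s≤s; s≤s⁻¹; _≤?_)
open import Data.Nat.Properties
open import Data.Fin using (Fin)
open import Data.Fin.Properties using (any?)
open import Data.Fin.Subset using (Subset; _∈_; _∉_; _⊆_; _⊂_; _⊃_; _∪_; _∩_; ∁; ⁅_⁆; ⊤; ⊥)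
open import Data.Fin.Subset.Properties
open import Data.Fin.Subset.Induction using (⊃-wellFounded; Acc; acc)
open import Data.Bool using (Bool; true; false)
open import Data.Bool.Properties using (T-≡)
open import Data.Product using (∃; _×_; _,_; proj₁; proj₂)
open import Data.Sum using (_⊎_; inj₁; inj₂; [_,_])
open import Data.Vec using (tabulate; lookup)
open import Data.Vec.Properties using (lookup∘tabulate; []=⇒lookup; lookup⇒[]=)
open import Function using (id; const; _∘_)
open import Function.Bundles using (_⇔_; mk⇔; Equivalence)
import Function.Properties.Equivalence as ⇔
open import Relation.Nullary using (Dec; yes; no; ¬?; contradiction)
open import Relation.Nullary.Decidable using (_×-dec_; isYes; decidable-stable; toWitness; fromWitness)
open import Relation.Binary.PropositionalEquality using (_≡_; _≢_; refl; sym; trans; cong; subst; module ≡-Reasoning)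

module _ {n : ℕ} where

  ∪-least : {P Q R : Subset n} → P ⊆ R → Q ⊆ R → P ∪ Q ⊆ R
  ∪-least {P} {Q} P⊆R Q⊆R x∈P∪Q = [ P⊆R , Q⊆R ] (x∈p∪q⁻ P Q x∈P∪Q)

  ∩-greatest : {P Q R : Subset n} → R ⊆ P → R ⊆ Q → R ⊆ P ∩ Q
  ∩-greatest R⊆P R⊆Q x∈R = x∈p∩q⁺ (R⊆P x∈R , R⊆Q x∈R)

  ⁅x⁆⊆ : {x : Fin n} {P : Subset n} → x ∈ P → ⁅ x ⁆ ⊆ P
  ⁅x⁆⊆ {x} x∈P y∈⁅x⁆ = subst (_∈ _) (sym (x∈⁅y⁆⇒x≡y x y∈⁅x⁆)) x∈P

  ⊆-or-witness : (P Q : Subset n) → P ⊆ Q ⊎ ∃ λ x → x ∈ P × x ∉ Q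
  ⊆-or-witness P Q with nonempty? (P ∩ ∁ Q)
  ... | yes (x , x∈P∩∁Q) with x∈p∩q⁻ P (∁ Q) x∈P∩∁Q
  ...   | x∈P , x∈∁Q = inj₂ (x , x∈P , x∈∁p⇒x∉p x∈∁Q)
  ⊆-or-witness P Q | no empty = inj₁ λ {x} x∈P →
    decidable-stable (x ∈? Q) (λ x∉Q → empty (x , x∈p∩q⁺ (x∈P , x∉p⇒x∈∁p x∉Q)))

  ∈-tabulate⁺ : {f : Fin n → Bool} {x : Fin n} → f x ≡ true → x ∈ tabulate f
  ∈-tabulate⁺ {f} {x} fx≡true = lookup⇒[]= x (tabulate f) (trans (lookup∘tabulate f x) fx≡true)

  ∈-tabulate⁻ : {f : Fin n → Bool} {x : Fin n} → x ∈ tabulate f → f x ≡ true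
  ∈-tabulate⁻ {f} {x} x∈ = trans (sym (lookup∘tabulate f x)) ([]=⇒lookup x∈)

  select : {P : Fin n → Set} → (∀ x → Dec (P x)) → Subset n
  select P? = tabulate (λ x → isYes (P? x))

  ∈-select⁺ : {P : Fin n → Set} (P? : ∀ x → Dec (P x)) {x : Fin n} → P x → x ∈ select P?
  ∈-select⁺ P? {x} p = ∈-tabulate⁺ (Equivalence.to T-≡ (fromWitness {a? = P? x} p))

  ∈-select⁻ : {P : Fin n → Set} (P? : ∀ x → Dec (P x)) {x : Fin n} → x ∈ select P? → P x
  ∈-select⁻ P? {x} x∈ = toWitness {a? = P? x} (Equivalence.from T-≡ (∈-tabulate⁻ x∈))

-- The entry test inside zeroSet is local to Defs and cannot be named, so both
-- directions go through lookup∘tabulate and a case split on the entry.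
∈-zeroSet⇔ : ∀ {r c} (Y : Pattern r c) {i j} → j ∈ zeroSet Y i ⇔ Y i j ≡ zer
∈-zeroSet⇔ Y {i} {j} = mk⇔ to from
  where
  to : j ∈ zeroSet Y i → Y i j ≡ zer
  to j∈ with Y i j | ∈-tabulate⁻ j∈
  ... | zer | _ = refl
  from : Y i j ≡ zer → j ∈ zeroSet Y i
  from Yij≡zer with lookup (zeroSet Y i) j in eq
  ... | true = lookup⇒[]= j (zeroSet Y i) eq
  ... | false with Y i j | Yij≡zer | trans (sym (lookup∘tabulate _ j)) eq
  ...   | zer | _ | ()

fundamentalPattern-zer⇔ : ∀ {n m} (h : Fin m → Subset n) {i e} → fundamentalPattern h i e ≡ zer ⇔ e ∈ h i
fundamentalPattern-zer⇔ h {i} {e} with e ∈? h i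
... | yes e∈hi = mk⇔ (const e∈hi) (const refl)
... | no e∉hi = mk⇔ (λ ()) (λ e∈hi → contradiction e∈hi e∉hi)

module _ {n : ℕ} (M : Matroid n) where

  private
    r : Subset n → ℕ
    r = rk M

  rk-⁅⁆≤1 : ∀ e → rk M ⁅ e ⁆ ≤ 1
  rk-⁅⁆≤1 e = subst (r ⁅ e ⁆ ≤_) (∣⁅x⁆∣≡1 e) (rk-bound M ⁅ e ⁆)

  rk-⊥≡0 : rk M ⊥ ≡ 0
  rk-⊥≡0 = n≤0⇒n≡0 (subst (r ⊥ ≤_) (∣⊥∣≡0 n) (rk-bound M ⊥))

  rk-∪≤+ : ∀ X Y → rk M (X ∪ Y) ≤ rk M X + rk M Y
  rk-∪≤+ X Y = m+n≤o⇒m≤o (r (X ∪ Y)) (rk-submod M X Y)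

  rk-∪⁅⁆≤ : ∀ X e → rk M (X ∪ ⁅ e ⁆) ≤ suc (rk M X)
  rk-∪⁅⁆≤ X e = begin
    r (X ∪ ⁅ e ⁆)  ≤⟨ rk-∪≤+ X ⁅ e ⁆ ⟩
    r X + r ⁅ e ⁆  ≤⟨ +-monoʳ-≤ (r X) (rk-⁅⁆≤1 e) ⟩
    r X + 1        ≡⟨ +-comm (r X) 1 ⟩
    suc (r X)      ∎
    where open ≤-Reasoning

  rk-∪⁅⁆-∉flat : ∀ {F e} → IsFlat M F → e ∉ F → rk M (F ∪ ⁅ e ⁆) ≡ suc (rk M F)
  rk-∪⁅⁆-∉flat {F} {e} F-flat e∉F = ≤-antisym (rk-∪⁅⁆≤ F e) (F-flat e e∉F)

  flat-closed : ∀ {F X e} → IsFlat M F → X ⊆ F → rk M (X ∪ ⁅ e ⁆) ≤ rk M X → e ∈ F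
  flat-closed {F} {X} {e} F-flat X⊆F X-spans-e with e ∈? F
  ... | yes e∈F = e∈F
  ... | no e∉F = contradiction (+-cancelʳ-≤ (r X) _ _ (begin
      r (F ∪ ⁅ e ⁆) + r X    ≤⟨ +-mono-≤ (rk-mono M (∪-least (p⊆p∪q Y) (⊆-trans (q⊆p∪q X ⁅ e ⁆) (q⊆p∪q F Y))))
                                          (rk-mono M (∩-greatest X⊆F (p⊆p∪q ⁅ e ⁆))) ⟩
      r (F ∪ Y) + r (F ∩ Y)  ≤⟨ rk-submod M F Y ⟩
      r F + r Y              ≤⟨ +-monoʳ-≤ (r F) X-spans-e ⟩
      r F + r X              ∎)) (<⇒≱ (F-flat e e∉F))
    where
    Y = X ∪ ⁅ e ⁆
    open ≤-Reasoning

  flat-⊆-rk≤⇒≡ : ∀ {F G} → IsFlat M F → F ⊆ G → rk M G ≤ rk M F → F ≡ G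
  flat-⊆-rk≤⇒≡ F-flat F⊆G G≤F = ⊆-antisym F⊆G λ x∈G →
    flat-closed F-flat ⊆-refl (≤-trans (rk-mono M (∪-least F⊆G (⁅x⁆⊆ x∈G))) G≤F)

  flat-⊂⇒rk< : ∀ {F G} → IsFlat M F → F ⊆ G → F ≢ G → rk M F < rk M G
  flat-⊂⇒rk< F-flat F⊆G F≢G = ≰⇒> (F≢G ∘ flat-⊆-rk≤⇒≡ F-flat F⊆G)

  flat-if-separated : ∀ {F} → (∀ j → j ∉ F → ∃ λ G → IsFlat M G × F ⊆ G × j ∉ G) → IsFlat M F
  flat-if-separated separate j j∉F with separate j j∉F
  ... | G , G-flat , F⊆G , j∉G = ≰⇒> (j∉G ∘ flat-closed G-flat F⊆G)

  ∩-flat : ∀ {F G} → IsFlat M F → IsFlat M G → IsFlat M (F ∩ G)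
  ∩-flat {F} {G} F-flat G-flat = flat-if-separated separate
    where
    separate : ∀ j → j ∉ F ∩ G → ∃ λ H → IsFlat M H × F ∩ G ⊆ H × j ∉ H
    separate j j∉F∩G with j ∈? F
    ... | yes j∈F = G , G-flat , p∩q⊆q F G , λ j∈G → j∉F∩G (x∈p∩q⁺ (j∈F , j∈G))
    ... | no j∉F = F , F-flat , p∩q⊆p F G , j∉F

  ⊤-flat : IsFlat M ⊤
  ⊤-flat e e∉⊤ = contradiction ∈⊤ e∉⊤

  rk-∩-flat< : ∀ {F X e} → IsFlat M F → e ∈ X → e ∉ F → rk M (X ∩ F) < rk M X
  rk-∩-flat< {F} {X} {e} F-flat e∈X e∉F = +-cancelˡ-≤ (r F) _ _ (begin
    r F + suc (r (X ∩ F))     ≡⟨ +-suc (r F) _ ⟩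
    suc (r F) + r (X ∩ F)     ≤⟨ +-monoˡ-≤ _ (≤-trans (F-flat e e∉F) (rk-mono M F∪e⊆X∪F)) ⟩
    r (X ∪ F) + r (X ∩ F)     ≤⟨ rk-submod M X F ⟩
    r X + r F                 ≡⟨ +-comm (r X) (r F) ⟩
    r F + r X                 ∎)
    where
    open ≤-Reasoning
    F∪e⊆X∪F : F ∪ ⁅ e ⁆ ⊆ X ∪ F
    F∪e⊆X∪F = ∪-least (q⊆p∪q X F) (⊆-trans (⁅x⁆⊆ e∈X) (p⊆p∪q F))

  record Closure (X : Subset n) : Set where
    field
      cl       : Subset n
      ⊆-cl     : X ⊆ cl
      cl-flat  : IsFlat M cl
      rk-cl    : rk M cl ≡ rk M X
      cl-least : ∀ {F} → IsFlat M F → X ⊆ F → cl ⊆ F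

  -- Adjoin elements that do not raise the rank until none is left; ⊃ is well-founded on Subset n.
  closure : ∀ X → Closure X
  closure X = go X (⊃-wellFounded X)
    where
    go : ∀ X → Acc _⊃_ X → Closure X
    go X (acc rec) with any? (λ e → ¬? (e ∈? X) ×-dec (r (X ∪ ⁅ e ⁆) ≤? r X))
    ... | no nothing-spanned = record
      { cl = X ; ⊆-cl = id ; cl-flat = λ e e∉X → ≰⇒> λ le → nothing-spanned (e , e∉X , le)
      ; rk-cl = refl ; cl-least = λ _ X⊆F → X⊆F }
    ... | yes (e , e∉X , X-spans-e) = record
      { cl = C.cl
      ; ⊆-cl = ⊆-trans (p⊆p∪q ⁅ e ⁆) C.⊆-cl
      ; cl-flat = C.cl-flat
      ; rk-cl = trans C.rk-cl (≤-antisym X-spans-e (rk-mono M (p⊆p∪q ⁅ e ⁆)))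
      ; cl-least = λ F-flat X⊆F → C.cl-least F-flat (∪-least X⊆F (⁅x⁆⊆ (flat-closed F-flat X⊆F X-spans-e)))
      }
      where
      X⊂X∪e : X ⊂ X ∪ ⁅ e ⁆
      X⊂X∪e = p⊆p∪q ⁅ e ⁆ , e , q⊆p∪q X ⁅ e ⁆ (x∈⁅x⁆ e) , e∉X
      module C = Closure (go (X ∪ ⁅ e ⁆) (rec X⊂X∪e))

  module _ (X : Subset n) where
    open Closure (closure X) public

  e∈cl-∪⁅e⁆ : ∀ X e → e ∈ cl (X ∪ ⁅ e ⁆)
  e∈cl-∪⁅e⁆ X e = ⊆-cl (X ∪ ⁅ e ⁆) (q⊆p∪q X ⁅ e ⁆ (x∈⁅x⁆ e))

  ⊆-cl-∪⁅⁆ : ∀ X e → X ⊆ cl (X ∪ ⁅ e ⁆)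
  ⊆-cl-∪⁅⁆ X e = ⊆-trans (p⊆p∪q ⁅ e ⁆) (⊆-cl (X ∪ ⁅ e ⁆))

  rk-cl-∪⁅⁆-∉flat : ∀ {F e} → IsFlat M F → e ∉ F → rk M (cl (F ∪ ⁅ e ⁆)) ≡ suc (rk M F)
  rk-cl-∪⁅⁆-∉flat {F} {e} F-flat e∉F = trans (rk-cl (F ∪ ⁅ e ⁆)) (rk-∪⁅⁆-∉flat F-flat e∉F)

  cl-exchange : ∀ {F e f} → IsFlat M F → e ∉ F → f ∉ cl (F ∪ ⁅ e ⁆) → e ∉ cl (F ∪ ⁅ f ⁆)
  cl-exchange {F} {e} {f} F-flat e∉F f∉Fe e∈Ff = f∉Fe (flat-closed (cl-flat (F ∪ ⁅ e ⁆)) (⊆-cl (F ∪ ⁅ e ⁆)) (begin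
    r ((F ∪ ⁅ e ⁆) ∪ ⁅ f ⁆)  ≤⟨ rk-mono M (∪-least (∪-least (⊆-cl-∪⁅⁆ F f) (⁅x⁆⊆ e∈Ff)) (⁅x⁆⊆ (e∈cl-∪⁅e⁆ F f))) ⟩
    r (cl (F ∪ ⁅ f ⁆))       ≡⟨ rk-cl-∪⁅⁆-∉flat F-flat f∉F ⟩
    suc (r F)                ≡⟨ rk-∪⁅⁆-∉flat F-flat e∉F ⟨
    r (F ∪ ⁅ e ⁆)            ∎))
    where
    open ≤-Reasoning
    f∉F : f ∉ F
    f∉F = f∉Fe ∘ ⊆-cl-∪⁅⁆ F e

  flat-between : ∀ {F G k} → IsFlat M F → IsFlat M G → F ⊆ G → rk M F ≤ k → k ≤ rk M G →
                 ∃ λ C → IsFlat M C × F ⊆ C × C ⊆ G × rk M C ≡ k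
  flat-between {F} {G} {k} F-flat G-flat F⊆G F≤k k≤G =
    go (k ∸ r F) F-flat F⊆G (m∸n+n≡m F≤k)
    where
    go : ∀ d {F} → IsFlat M F → F ⊆ G → d + rk M F ≡ k →
         ∃ λ C → IsFlat M C × F ⊆ C × C ⊆ G × rk M C ≡ k
    go zero F-flat F⊆G refl = _ , F-flat , ⊆-refl , F⊆G , refl
    go (suc d) {F} F-flat F⊆G d+1+F≡k with ⊆-or-witness G F
    ... | inj₁ G⊆F = contradiction (≤-trans k≤G (rk-mono M G⊆F)) (<⇒≱ (subst (r F <_) d+1+F≡k (s≤s (m≤n+m (r F) d))))
    ... | inj₂ (e , e∈G , e∉F) with go d (cl-flat (F ∪ ⁅ e ⁆)) (cl-least (F ∪ ⁅ e ⁆) G-flat (∪-least F⊆G (⁅x⁆⊆ e∈G)))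
                                       (trans (cong (d +_) (rk-cl-∪⁅⁆-∉flat F-flat e∉F)) (trans (+-suc d (r F)) d+1+F≡k))
    ...   | C , C-flat , Fe⊆C , C⊆G , C≡k = C , C-flat , ⊆-trans (⊆-cl-∪⁅⁆ F e) Fe⊆C , C⊆G , C≡k

  rk-cl-⊥≡0 : rk M (cl ⊥) ≡ 0
  rk-cl-⊥≡0 = trans (rk-cl ⊥) rk-⊥≡0

  flat-below : ∀ {F k} → IsFlat M F → k ≤ rk M F → ∃ λ G → IsFlat M G × G ⊆ F × rk M G ≡ k
  flat-below {F} F-flat k≤F
    with flat-between (cl-flat ⊥) F-flat (cl-least ⊥ F-flat ⊥⊆) (≤-trans (≤-reflexive rk-cl-⊥≡0) z≤n) k≤F
  ... | G , G-flat , _ , G⊆F , G≡k = G , G-flat , G⊆F , G≡k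

  cover-avoiding : ∀ {F e} → IsFlat M F → e ∉ F → suc (rk M F) < rank M →
                   ∃ λ G → IsFlat M G × F ⊆ G × e ∉ G × rk M G ≡ suc (rk M F)
  cover-avoiding {F} {e} F-flat e∉F F+1<⊤ with ⊆-or-witness ⊤ (cl (F ∪ ⁅ e ⁆))
  ... | inj₁ ⊤⊆Fe = contradiction (≤-trans (rk-mono M ⊤⊆Fe) (≤-reflexive (rk-cl-∪⁅⁆-∉flat F-flat e∉F))) (<⇒≱ F+1<⊤)
  ... | inj₂ (f , _ , f∉Fe) =
    cl (F ∪ ⁅ f ⁆) , cl-flat (F ∪ ⁅ f ⁆) , ⊆-cl-∪⁅⁆ F f , cl-exchange F-flat e∉F f∉Fe ,
    rk-cl-∪⁅⁆-∉flat F-flat (f∉Fe ∘ ⊆-cl-∪⁅⁆ F e)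

  hyperplane-avoiding : ∀ {F e} → IsFlat M F → e ∉ F → ∃ λ H → IsHyperplane M H × F ⊆ H × e ∉ H
  hyperplane-avoiding {F} {e} F-flat e∉F =
    go (rank M ∸ suc (r F)) F-flat e∉F (m∸n+n≡m (≤-trans (F-flat e e∉F) (rk-mono M ⊆⊤)))
    where
    go : ∀ d {F} → IsFlat M F → e ∉ F → d + suc (rk M F) ≡ rank M →
         ∃ λ H → IsHyperplane M H × F ⊆ H × e ∉ H
    go zero F-flat e∉F F+1≡⊤ = _ , (F-flat , F+1≡⊤) , ⊆-refl , e∉F
    go (suc d) {F} F-flat e∉F d+1+F+1≡⊤ with cover-avoiding F-flat e∉F (subst (suc (r F) <_) d+1+F+1≡⊤ (s≤s (m≤n+m _ d)))
    ... | G , G-flat , F⊆G , e∉G , G≡F+1 with go d G-flat e∉G (trans (cong (λ k → d + suc k) G≡F+1) (trans (+-suc d _) d+1+F+1≡⊤))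
    ...   | H , H-hyperplane , G⊆H , e∉H = H , H-hyperplane , ⊆-trans F⊆G G⊆H , e∉H

  covers-meet : ∀ {F G Z} → IsFlat M F → IsFlat M G → IsFlat M Z → Z ⊆ F → Z ⊆ G → F ≢ G →
                rk M F ≡ suc (rk M Z) → rk M G ≡ suc (rk M Z) → F ∩ G ⊆ Z
  covers-meet {F} {G} {Z} F-flat G-flat Z-flat Z⊆F Z⊆G F≢G F≡Z+1 G≡Z+1 with ⊆-or-witness F G
  ... | inj₁ F⊆G = contradiction (flat-⊆-rk≤⇒≡ F-flat F⊆G (≤-reflexive (trans G≡Z+1 (sym F≡Z+1)))) F≢G
  ... | inj₂ (x , x∈F , x∉G) = ⊆-reflexive (sym (flat-⊆-rk≤⇒≡ Z-flat (∩-greatest Z⊆F Z⊆G) F∩G≤Z))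
    where
    F∩G≤Z : r (F ∩ G) ≤ r Z
    F∩G≤Z = s≤s⁻¹ (subst (r (F ∩ G) <_) F≡Z+1 (rk-∩-flat< G-flat x∈F x∉G))

  simple-if-flats : IsFlat M ⊥ → (∀ e → IsFlat M ⁅ e ⁆) → Simple M
  simple-if-flats ⊥-flat ⁅⁆-flat = rk-⁅⁆≡1 , rk-pair≡2
    where
    rk-⁅⁆≡1 : ∀ e → r ⁅ e ⁆ ≡ 1
    rk-⁅⁆≡1 e = ≤-antisym (rk-⁅⁆≤1 e) (≤-trans (s≤s z≤n) (≤-trans (⊥-flat e ∉⊥) (rk-mono M (∪-least ⊥⊆ ⊆-refl))))
    rk-pair≡2 : ∀ e f → e ≢ f → r (⁅ e ⁆ ∪ ⁅ f ⁆) ≡ 2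
    rk-pair≡2 e f e≢f = ≤-antisym
      (≤-trans (rk-∪≤+ ⁅ e ⁆ ⁅ f ⁆) (+-mono-≤ (rk-⁅⁆≤1 e) (rk-⁅⁆≤1 f)))
      (subst (λ k → suc k ≤ r (⁅ e ⁆ ∪ ⁅ f ⁆)) (rk-⁅⁆≡1 e) (⁅⁆-flat e f (x≢y⇒x∉⁅y⁆ (e≢f ∘ sym))))

  antitone-rank-sum : (g : Subset n → ℕ) →
    (∀ {F G} → IsFlat M F → IsFlat M G → F ⊆ G → F ≢ G → g G < g F) →
    ∀ {F G} → IsFlat M F → IsFlat M G → F ⊆ G → g G + rk M G ≤ g F + rk M F
  antitone-rank-sum g g-strict {F} {G} F-flat G-flat F⊆G =
    go (r G ∸ r F) F-flat F⊆G (m∸n+n≡m (rk-mono M F⊆G))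
    where
    go : ∀ d {F} → IsFlat M F → F ⊆ G → d + rk M F ≡ rk M G → g G + r G ≤ g F + r F
    go zero F-flat F⊆G rF≡rG rewrite flat-⊆-rk≤⇒≡ F-flat F⊆G (≤-reflexive (sym rF≡rG)) = ≤-refl
    go (suc d) {F} F-flat F⊆G d+1+F≡G
      with flat-between F-flat G-flat F⊆G (n≤1+n (r F)) (subst (suc (r F) ≤_) d+1+F≡G (s≤s (m≤n+m _ d)))
    ... | C , C-flat , F⊆C , C⊆G , C≡F+1 = begin
      g G + r G        ≤⟨ go d C-flat C⊆G (trans (cong (d +_) C≡F+1) (trans (+-suc d _) d+1+F≡G)) ⟩
      g C + r C        ≡⟨ cong (g C +_) C≡F+1 ⟩
      g C + suc (r F)  ≡⟨ +-suc (g C) (r F) ⟩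
      suc (g C) + r F  ≤⟨ +-monoˡ-≤ (r F) (g-strict F-flat C-flat F⊆C F≢C) ⟩
      g F + r F        ∎
      where
      open ≤-Reasoning
      F≢C : F ≢ C
      F≢C F≡C = 1+n≢n (sym (trans (cong r F≡C) C≡F+1))

module _ {n m : ℕ} (h : Fin m → Subset n) where

  hyperplanesThrough : Fin n → Subset m
  hyperplanesThrough e = zeroSet (transpose (fundamentalPattern h)) e

  ∈-hyperplanesThrough⇔ : ∀ {e i} → i ∈ hyperplanesThrough e ⇔ e ∈ h i
  ∈-hyperplanesThrough⇔ = ⇔.trans (∈-zeroSet⇔ (transpose (fundamentalPattern h))) (fundamentalPattern-zer⇔ h)

  hyperplanesContaining : Subset n → Subset m
  hyperplanesContaining F = select (λ i → F ⊆? h i)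

  ∈-hyperplanesContaining⁺ : ∀ {F i} → F ⊆ h i → i ∈ hyperplanesContaining F
  ∈-hyperplanesContaining⁺ {F} = ∈-select⁺ (λ i → F ⊆? h i)

  ∈-hyperplanesContaining⁻ : ∀ {F i} → i ∈ hyperplanesContaining F → F ⊆ h i
  ∈-hyperplanesContaining⁻ {F} = ∈-select⁻ (λ i → F ⊆? h i)

module _ {n m : ℕ} (M : Matroid n) (h : Fin m → Subset n) (enum : IsHyperplaneEnum M h) (M' : Matroid m) where

  private
    r : Subset n → ℕ
    r = rk M

    h-injective : ∀ i j → h i ≡ h j → i ≡ j
    h-injective = proj₁ enum

    h-hyperplane : ∀ i → IsHyperplane M (h i)
    h-hyperplane = proj₁ (proj₂ enum)

    h-surjective : ∀ H → IsHyperplane M H → ∃ λ i → h i ≡ H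
    h-surjective = proj₂ (proj₂ enum)

    h-flat : ∀ i → IsFlat M (h i)
    h-flat i = proj₁ (h-hyperplane i)

    φ : Subset n → Subset m
    φ = hyperplanesContaining h

  hyperplanesContaining-flat : M' ∈R transpose (fundamentalPattern h) → ∀ F → IsFlat M' (φ F)
  hyperplanesContaining-flat M'∈R F = flat-if-separated M' separate
    where
    separate : ∀ j → j ∉ φ F → ∃ λ Z → IsFlat M' Z × φ F ⊆ Z × j ∉ Z
    separate j j∉φF with ⊆-or-witness F (h j)
    ... | inj₁ F⊆hj = contradiction (∈-hyperplanesContaining⁺ h F⊆hj) j∉φF
    ... | inj₂ (e , e∈F , e∉hj) =
      hyperplanesThrough h e , M'∈R e ,
      (λ i∈φF → Equivalence.from (∈-hyperplanesThrough⇔ h) (∈-hyperplanesContaining⁻ h i∈φF e∈F)) ,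
      e∉hj ∘ Equivalence.to (∈-hyperplanesThrough⇔ h)

  ⊆-if-hyperplanesContaining-⊇ : ∀ {F G} → IsFlat M G → φ G ⊆ φ F → F ⊆ G
  ⊆-if-hyperplanesContaining-⊇ {F} {G} G-flat φG⊆φF {e} e∈F = decidable-stable (e ∈? G) λ e∉G →
    let H , H-hyperplane , G⊆H , e∉H = hyperplane-avoiding M G-flat e∉G
        i , hi≡H = h-surjective H H-hyperplane
        G⊆hi = subst (G ⊆_) (sym hi≡H) G⊆H
    in  e∉H (subst (e ∈_) hi≡H (∈-hyperplanesContaining⁻ h (φG⊆φF (∈-hyperplanesContaining⁺ h G⊆hi)) e∈F))

  hyperplanesContaining-injective : ∀ F G → IsFlat M F → IsFlat M G → φ F ≡ φ G → F ≡ G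
  hyperplanesContaining-injective F G F-flat G-flat φF≡φG = ⊆-antisym
    (⊆-if-hyperplanesContaining-⊇ G-flat (⊆-reflexive (sym φF≡φG)))
    (⊆-if-hyperplanesContaining-⊇ F-flat (⊆-reflexive φF≡φG))

  hyperplanesContaining-antitone : ∀ {F G} → F ⊆ G → φ G ⊆ φ F
  hyperplanesContaining-antitone F⊆G i∈φG = ∈-hyperplanesContaining⁺ h (⊆-trans F⊆G (∈-hyperplanesContaining⁻ h i∈φG))

  hyperplanesContaining-hyperplane : ∀ i → φ (h i) ≡ ⁅ i ⁆
  hyperplanesContaining-hyperplane i = ⊆-antisym only-i (⁅x⁆⊆ (∈-hyperplanesContaining⁺ h ⊆-refl))
    where
    only-i : φ (h i) ⊆ ⁅ i ⁆
    only-i {j} j∈φhi = subst (_∈ ⁅ i ⁆) (h-injective i j hi≡hj) (x∈⁅x⁆ i)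
      where
      hi≡hj : h i ≡ h j
      hi≡hj = flat-⊆-rk≤⇒≡ M (h-flat i) (∈-hyperplanesContaining⁻ h j∈φhi)
        (≤-reflexive (suc-injective (trans (proj₂ (h-hyperplane j)) (sym (proj₂ (h-hyperplane i))))))

  hyperplanesContaining-⊤ : φ ⊤ ≡ ⊥
  hyperplanesContaining-⊤ = ⊆-antisym no-hyperplane-contains-⊤ ⊥⊆
    where
    no-hyperplane-contains-⊤ : φ ⊤ ⊆ ⊥
    no-hyperplane-contains-⊤ {i} i∈φ⊤ = contradiction
      (≤-trans (≤-reflexive (proj₂ (h-hyperplane i))) (rk-mono M (∈-hyperplanesContaining⁻ h i∈φ⊤))) 1+n≰n

  adjoint-if-∈R : M' ∈R transpose (fundamentalPattern h) × rank M' ≡ rank M → IsAdjoint M h M'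
  adjoint-if-∈R (M'∈R , rank≡) =
    M'-simple , rank≡ , φ , (λ F _ → φ-flat F) , hyperplanesContaining-injective ,
    (λ _ _ _ _ → hyperplanesContaining-antitone) ,
    λ i → hyperplanesContaining-hyperplane i , φ-flat (h i) ,
          trans (cong (rk M') (hyperplanesContaining-hyperplane i)) (proj₁ M'-simple i)
    where
    φ-flat : ∀ F → IsFlat M' (φ F)
    φ-flat = hyperplanesContaining-flat M'∈R
    M'-simple : Simple M'
    M'-simple = simple-if-flats M'
      (subst (IsFlat M') hyperplanesContaining-⊤ (φ-flat ⊤))
      (λ i → subst (IsFlat M') (hyperplanesContaining-hyperplane i) (φ-flat (h i)))

  module FromAdjoint
    (M'-simple : Simple M')
    (rank≡ : rank M' ≡ rank M)
    (ψ : Subset n → Subset m)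
    (ψ-flat : ∀ F → IsFlat M F → IsFlat M' (ψ F))
    (ψ-injective : ∀ F G → IsFlat M F → IsFlat M G → ψ F ≡ ψ G → F ≡ G)
    (ψ-antitone : ∀ F G → IsFlat M F → IsFlat M G → F ⊆ G → ψ G ⊆ ψ F)
    (ψ-points : ∀ i → ψ (h i) ≡ ⁅ i ⁆ × IsPoint M' (ψ (h i)))
    where

    private
      g : Subset n → ℕ
      g = rk M' ∘ ψ

    ψ-strict : ∀ {F G} → IsFlat M F → IsFlat M G → F ⊆ G → F ≢ G → g G < g F
    ψ-strict F-flat G-flat F⊆G F≢G = flat-⊂⇒rk< M' (ψ-flat _ G-flat) (ψ-antitone _ _ F-flat G-flat F⊆G)
      (F≢G ∘ sym ∘ ψ-injective _ _ G-flat F-flat)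

    i∈ψhi : ∀ i → i ∈ ψ (h i)
    i∈ψhi i = subst (i ∈_) (sym (proj₁ (ψ-points i))) (x∈⁅x⁆ i)

    -- ψ strictly reverses chains of flats; compare the chain from cl ⊥ up to F (upper bound)
    -- with the chain from F up to a hyperplane, whose image is a point (lower bound).
    rk-ψ+rk≡rank : ∀ {F} → IsFlat M F → g F + rk M F ≡ rank M
    rk-ψ+rk≡rank {F} F-flat = ≤-antisym upper lower
      where
      open ≤-Reasoning
      upper : g F + r F ≤ rank M
      upper = begin
        g F + r F              ≤⟨ antitone-rank-sum M g ψ-strict (cl-flat M ⊥) F-flat (cl-least M ⊥ F-flat ⊥⊆) ⟩
        g (cl M ⊥) + r (cl M ⊥) ≡⟨ cong (g (cl M ⊥) +_) (rk-cl-⊥≡0 M) ⟩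
        g (cl M ⊥) + 0         ≡⟨ +-identityʳ _ ⟩
        g (cl M ⊥)             ≤⟨ rk-mono M' ⊆⊤ ⟩
        rank M'                ≡⟨ rank≡ ⟩
        rank M                 ∎
      lower : rank M ≤ g F + r F
      lower with ⊆-or-witness ⊤ F
      ... | inj₁ ⊤⊆F = ≤-trans (rk-mono M ⊤⊆F) (m≤n+m (r F) (g F))
      ... | inj₂ (e , _ , e∉F) with hyperplane-avoiding M F-flat e∉F
      ...   | H , H-hyperplane , F⊆H , _ with h-surjective H H-hyperplane
      ...     | i , refl = begin
        rank M               ≡⟨ proj₂ (h-hyperplane i) ⟨
        1 + r (h i)          ≡⟨ cong (_+ r (h i)) (proj₂ (proj₂ (ψ-points i))) ⟨
        g (h i) + r (h i)    ≤⟨ antitone-rank-sum M g ψ-strict F-flat (h-flat i) F⊆H ⟩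
        g F + r F            ∎

    rk-ψ-of-cover : ∀ {A X} → IsFlat M A → IsFlat M X → suc (rk M A) ≡ rk M X → g A ≡ suc (g X)
    rk-ψ-of-cover {A} {X} A-flat X-flat A+1≡X = +-cancelʳ-≡ (r A) _ _ (begin
      g A + r A        ≡⟨ rk-ψ+rk≡rank A-flat ⟩
      rank M           ≡⟨ rk-ψ+rk≡rank X-flat ⟨
      g X + r X        ≡⟨ cong (g X +_) A+1≡X ⟨
      g X + suc (r A)  ≡⟨ +-suc (g X) (r A) ⟩
      suc (g X) + r A  ∎)
      where open ≡-Reasoning

    ψ-meet : ∀ {A B X} → IsFlat M A → IsFlat M B → IsFlat M X → A ⊆ X → B ⊆ X → A ≢ B →
             suc (rk M A) ≡ rk M X → suc (rk M B) ≡ rk M X → ψ A ∩ ψ B ⊆ ψ X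
    ψ-meet A-flat B-flat X-flat A⊆X B⊆X A≢B A+1≡X B+1≡X = covers-meet M'
      (ψ-flat _ A-flat) (ψ-flat _ B-flat) (ψ-flat _ X-flat)
      (ψ-antitone _ _ A-flat X-flat A⊆X) (ψ-antitone _ _ B-flat X-flat B⊆X)
      (A≢B ∘ ψ-injective _ _ A-flat B-flat)
      (rk-ψ-of-cover A-flat X-flat A+1≡X) (rk-ψ-of-cover B-flat X-flat B+1≡X)

    module _ {e j F} (e∉hj : e ∉ h j) (F-flat : IsFlat M F) (e∈F : e ∈ F) (j∈ψF : j ∈ ψ F) where

      private
        e-nonloop : 1 ≤ r ⁅ e ⁆
        e-nonloop = ≤-trans (s≤s z≤n) (rk-∩-flat< M (h-flat j) (x∈⁅x⁆ e) e∉hj)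

      ∈ψ-of-point : ∀ {X} → IsFlat M X → rk M X ≡ 1 → e ∈ X → j ∈ ψ X
      ∈ψ-of-point {X} X-flat X≡1 e∈X = ψ-antitone _ _ X-flat F-flat X⊆F j∈ψF
        where
        X⊆F : X ⊆ F
        X⊆F {x} x∈X = flat-closed M F-flat (⁅x⁆⊆ e∈F) (begin
          r (⁅ e ⁆ ∪ ⁅ x ⁆)  ≤⟨ rk-mono M (∪-least (⁅x⁆⊆ e∈X) (⁅x⁆⊆ x∈X)) ⟩
          r X                ≡⟨ X≡1 ⟩
          1                  ≤⟨ e-nonloop ⟩
          r ⁅ e ⁆            ∎)
          where open ≤-Reasoning

      -- For a copoint G of A = X ∩ h j, both A and B = cl (G ∪ ⁅ e ⁆) are copoints of X, and
      -- h j meets B in the copoint G of B; j ∈ ψ A since A ⊆ h j, j ∈ ψ B by induction,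
      -- and ψ-meet gives j ∈ ψ X.
      ∈ψ-if-meets-in-copoint : ∀ t {X} → IsFlat M X → rk M X ≡ suc t → e ∈ X → suc (rk M (X ∩ h j)) ≡ rk M X → j ∈ ψ X
      ∈ψ-if-meets-in-copoint zero X-flat X≡1 e∈X _ = ∈ψ-of-point X-flat X≡1 e∈X
      ∈ψ-if-meets-in-copoint (suc t) {X} X-flat X≡t+2 e∈X A+1≡X with ∩-flat M X-flat (h-flat j)
      ... | A-flat with flat-below M A-flat A≥t
        where
        A≥t : t ≤ r (X ∩ h j)
        A≥t = subst (t ≤_) (sym (suc-injective (trans A+1≡X X≡t+2))) (n≤1+n t)
      ...   | G , G-flat , G⊆A , G≡t =
        ψ-meet A-flat B-flat X-flat (p∩q⊆p X (h j)) B⊆X A≢B A+1≡X B+1≡X (x∈p∩q⁺ (j∈ψA , j∈ψB))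
        where
        A = X ∩ h j
        B = cl M (G ∪ ⁅ e ⁆)
        B-flat = cl-flat M (G ∪ ⁅ e ⁆)
        e∈B = e∈cl-∪⁅e⁆ M G e
        B≡t+1 : r B ≡ suc t
        B≡t+1 = trans (rk-cl-∪⁅⁆-∉flat M G-flat (e∉hj ∘ p∩q⊆q X (h j) ∘ G⊆A)) (cong suc G≡t)
        B⊆X : B ⊆ X
        B⊆X = cl-least M _ X-flat (∪-least (⊆-trans G⊆A (p∩q⊆p X (h j))) (⁅x⁆⊆ e∈X))
        B+1≡X : suc (r B) ≡ r X
        B+1≡X = trans (cong suc B≡t+1) (sym X≡t+2)
        B∩hj+1≡B : suc (r (B ∩ h j)) ≡ r B
        B∩hj+1≡B = ≤-antisym (rk-∩-flat< M (h-flat j) e∈B e∉hj)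
          (subst (_≤ suc (r (B ∩ h j))) (trans (cong suc G≡t) (sym B≡t+1))
                 (s≤s (rk-mono M (∩-greatest (⊆-cl-∪⁅⁆ M G e) (⊆-trans G⊆A (p∩q⊆q X (h j)))))))
        j∈ψB : j ∈ ψ B
        j∈ψB = ∈ψ-if-meets-in-copoint t B-flat B≡t+1 e∈B B∩hj+1≡B
        j∈ψA : j ∈ ψ A
        j∈ψA = ψ-antitone _ _ A-flat (h-flat j) (p∩q⊆q X (h j)) (i∈ψhi j)
        A≢B : A ≢ B
        A≢B A≡B = e∉hj (p∩q⊆q X (h j) (subst (e ∈_) (sym A≡B) e∈B))

    -- If e ∈ F ∖ h j, the induction above reaches X = ⊤, but ψ ⊤ has rank 0.
    ∈ψ⇒⊆ : ∀ {F j} → IsFlat M F → j ∈ ψ F → F ⊆ h j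
    ∈ψ⇒⊆ {F} {j} F-flat j∈ψF {e} e∈F = decidable-stable (e ∈? h j) λ e∉hj →
      let j∈ψ⊤ = ∈ψ-if-meets-in-copoint e∉hj F-flat e∈F j∈ψF (r (h j)) (⊤-flat M) ⊤≡hj+1 ∈⊤
                   (trans (cong (suc ∘ r) (∩-identityˡ (h j))) (sym ⊤≡hj+1))
      in  1+n≰n (begin
            1           ≡⟨ proj₁ M'-simple j ⟨
            rk M' ⁅ j ⁆ ≤⟨ rk-mono M' (⁅x⁆⊆ j∈ψ⊤) ⟩
            g ⊤         ≡⟨ +-cancelʳ-≡ (rank M) _ 0 (rk-ψ+rk≡rank (⊤-flat M)) ⟩
            0           ∎)
      where
      open ≤-Reasoning
      ⊤≡hj+1 : rank M ≡ suc (r (h j))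
      ⊤≡hj+1 = sym (proj₂ (h-hyperplane j))

    hyperplanesThrough-flat : ∀ e → IsFlat M' (hyperplanesThrough h e)
    hyperplanesThrough-flat e = flat-if-separated M' λ j j∉ →
      ψ P , ψ-flat P P-flat , ⊆ψP ,
      λ j∈ψP → j∉ (Equivalence.from (∈-hyperplanesThrough⇔ h) (∈ψ⇒⊆ P-flat j∈ψP (⊆-cl M ⁅ e ⁆ (x∈⁅x⁆ e))))
      where
      P = cl M ⁅ e ⁆
      P-flat = cl-flat M ⁅ e ⁆
      ⊆ψP : hyperplanesThrough h e ⊆ ψ P
      ⊆ψP {i} i∈ = ψ-antitone _ _ P-flat (h-flat i) P⊆hi (i∈ψhi i)
        where
        P⊆hi : P ⊆ h i
        P⊆hi = cl-least M _ (h-flat i) (⁅x⁆⊆ (Equivalence.to (∈-hyperplanesThrough⇔ h) i∈))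

  ∈R-if-adjoint : IsAdjoint M h M' → M' ∈R transpose (fundamentalPattern h) × rank M' ≡ rank M
  ∈R-if-adjoint (M'-simple , rank≡ , ψ , ψ-flat , ψ-injective , ψ-antitone , ψ-points) =
    FromAdjoint.hyperplanesThrough-flat M'-simple rank≡ ψ ψ-flat ψ-injective ψ-antitone ψ-points , rank≡

theorem4p6 : ∀ {n m} (M : Matroid n) (h : Fin m → Subset n) → IsHyperplaneEnum M h →
    (M' : Matroid m) →
    IsAdjoint M h M' ⇔ (M' ∈R transpose (fundamentalPattern h) × rank M' ≡ rank M)
theorem4p6 M h enum M' = mk⇔ (∈R-if-adjoint M h enum M') (adjoint-if-∈R M h enum M')
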